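{- Let $n \geq 2$ be an integer. If $n$ is even, then $2x_n \geq x_{n - 1} + x_{n + 1}$. If $n$ is odd, then $2x_n \leq x_{n - 1} + x_{n + 1}$.
   Context: The sequence $(x_n)_{n\ge1}$ is defined by $x_1 = 0, x_2 = 1, x_3 = 2, x_4 = 4, x_5 = 5$ and, for $n \geq 6$, $$x_n = (n - 1) + \begin{cases} x_{\frac{n + 1}{2}} + x_{\frac{n - 3}{2}}, & n \equiv 1 \pmod 4,\\ 2 x_{\frac{n - 1}{2}}, & n \equiv 3 \pmod 4,\\ x_{\frac{n}{2}} + x_{\frac{n - 2}{2}}, & n \text{ even}. \end{cases}$$ -}

module Defs where

open import Data.Nat using (ℕ; zero; suc; _+_; _*_; _∸_)

-- The sequence (x_n)_{n ≥ 1}:  x₁ = 0, x₂ = 1, x₃ = 2, x₄ = 4, x₅ = 5 and for n ≥ 6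
--   x_n = (n - 1) + x_{(n+1)/2} + x_{(n-3)/2}   if n ≡ 1 (mod 4)
--   x_n = (n - 1) + 2 x_{(n-1)/2}               if n ≡ 3 (mod 4)
--   x_n = (n - 1) + x_{n/2} + x_{(n-2)/2}       if n even.
-- Implemented by structural recursion on a fuel argument f; `go f n` equals x_n
-- whenever f ≥ n (all recursive calls are on strictly smaller indices ≥ 1).
-- Index 0 is not part of the sequence; x 0 is set to 0 by convention (never used below).

-- Residue class of n modulo 4 together with the quotient: n = 4q + r.
data Mod4 : Set where
  r0 r1 r2 r3 : ℕ → Mod4

mod4 : ℕ → Mod4
mod4 0 = r0 0
mod4 1 = r1 0
mod4 2 = r2 0
mod4 3 = r3 0
mod4 (suc (suc (suc (suc n)))) with mod4 n
... | r0 q = r0 (suc q)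
... | r1 q = r1 (suc q)
... | r2 q = r2 (suc q)
... | r3 q = r3 (suc q)

go : ℕ → ℕ → ℕ
go zero    _ = 0
go (suc f) 0 = 0
go (suc f) 1 = 0
go (suc f) 2 = 1
go (suc f) 3 = 2
go (suc f) 4 = 4
go (suc f) 5 = 5
go (suc f) n@(suc m) with mod4 n
-- n = 4q:     n/2 = 2q,  (n-2)/2 = 2q - 1
... | r0 q = m + (go f (2 * q) + go f (2 * q ∸ 1))
-- n = 4q+1:   (n+1)/2 = 2q+1,  (n-3)/2 = 2q-1
... | r1 q = m + (go f (2 * q + 1) + go f (2 * q ∸ 1))
-- n = 4q+2:   n/2 = 2q+1,  (n-2)/2 = 2q
... | r2 q = m + (go f (2 * q + 1) + go f (2 * q))
-- n = 4q+3:   (n-1)/2 = 2q+1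
... | r3 q = m + 2 * go f (2 * q + 1)

x : ℕ → ℕ
x n = go n n

-- sanity check against values computed independently from the recursion
open import Relation.Binary.PropositionalEquality using (_≡_; refl)
open import Data.List using (List; _∷_; []; map; upTo)
private
  t : map (λ i → x (suc i)) (upTo 39) ≡ (0 ∷ 1 ∷ 2 ∷ 4 ∷ 5 ∷ 8 ∷ 10 ∷ 13 ∷ 15 ∷ 18 ∷ 20 ∷ 24 ∷ 27 ∷ 31 ∷ 34 ∷ 38 ∷ 41 ∷ 45 ∷ 48 ∷ 52 ∷ 55 ∷ 59 ∷ 62 ∷ 67 ∷ 71 ∷ 76 ∷ 80 ∷ 85 ∷ 89 ∷ 94 ∷ 98 ∷ 103 ∷ 107 ∷ 112 ∷ 116 ∷ 121 ∷ 125 ∷ 130 ∷ 134 ∷ [])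
  t = refl

-- Write Δn = x(n+1) − x(n). Unfolding the recursion twice shows that Δ grows by exactly one
-- along halving: Δ(4k) = Δ(2k) + 1, Δ(4k+1) = Δ(2k−1) + 1, Δ(4k+2) = Δ(2k) + 1 and
-- Δ(4k+3) = Δ(2k+1) + 1 for k large enough. By strong induction along these equations,
-- Δ(2m+2) ≤ Δ(2m+1) and Δ(2m+1) ≤ Δ(2m+3), after checking a few small cases by computation.
-- The first inequality is the even case of the theorem; chaining the two gives the odd case.
module Submission where

open import Defs
open import Data.Nat using (ℕ; zero; suc; _+_; _*_; _∸_; _≤_; _≥_; _<_; _%_; _≤ᵇ_; s≤s)
open import Data.Nat.Properties
open import Data.Nat.DivMod using ([m+kn]%n≡m%n)
open import Data.Nat.Induction using (<-wellFounded)
open import Data.Nat.Tactic.RingSolver using (solve-∀; solve)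
open import Data.List using (_∷_; [])
open import Data.Bool using (T)
open import Data.Product using (_×_; _,_)
open import Induction.WellFounded using (Acc; acc)
open import Relation.Nullary using (contradiction)
open import Relation.Binary.PropositionalEquality
  using (_≡_; refl; sym; trans; cong; cong₂; subst; subst₂; module ≡-Reasoning)

≤-by-computation : ∀ {a b} {_ : T (a ≤ᵇ b)} → a ≤ b
≤-by-computation {a} {b} {t} = ≤ᵇ⇒≤ a b t

mod4-r0 : ∀ j → mod4 (j * 4) ≡ r0 j
mod4-r0 zero = refl
mod4-r0 (suc j) rewrite mod4-r0 j = refl

mod4-r1 : ∀ j → mod4 (1 + j * 4) ≡ r1 j
mod4-r1 zero = refl
mod4-r1 (suc j) rewrite mod4-r1 j = refl

mod4-r2 : ∀ j → mod4 (2 + j * 4) ≡ r2 j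
mod4-r2 zero = refl
mod4-r2 (suc j) rewrite mod4-r2 j = refl

mod4-r3 : ∀ j → mod4 (3 + j * 4) ≡ r3 j
mod4-r3 zero = refl
mod4-r3 (suc j) rewrite mod4-r3 j = refl

2*[k+j]≡k*2+j*2 : ∀ k j → 2 * (k + j) ≡ k * 2 + j * 2
2*[k+j]≡k*2+j*2 = solve-∀

2*[k+j]+1≡1+k*2+j*2 : ∀ k j → 2 * (k + j) + 1 ≡ suc (k * 2 + j * 2)
2*[k+j]+1≡1+k*2+j*2 = solve-∀

go-4k : ∀ f j → go (suc f) (8 + j * 4) ≡ 7 + j * 4 + (go f (4 + j * 2) + go f (3 + j * 2))
go-4k f j rewrite mod4-r0 j = cong (λ i → 7 + j * 4 + (go f i + go f (i ∸ 1))) (2*[k+j]≡k*2+j*2 2 j)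

go-4k+1 : ∀ f j → go (suc f) (9 + j * 4) ≡ 8 + j * 4 + (go f (5 + j * 2) + go f (3 + j * 2))
go-4k+1 f j rewrite mod4-r1 j =
  cong₂ (λ i i′ → 8 + j * 4 + (go f i + go f (i′ ∸ 1))) (2*[k+j]+1≡1+k*2+j*2 2 j) (2*[k+j]≡k*2+j*2 2 j)

go-4k+2 : ∀ f j → go (suc f) (6 + j * 4) ≡ 5 + j * 4 + (go f (3 + j * 2) + go f (2 + j * 2))
go-4k+2 f j rewrite mod4-r2 j =
  cong₂ (λ i i′ → 5 + j * 4 + (go f i + go f i′)) (2*[k+j]+1≡1+k*2+j*2 1 j) (2*[k+j]≡k*2+j*2 1 j)

go-4k+3 : ∀ f j → go (suc f) (7 + j * 4) ≡ 6 + j * 4 + 2 * go f (3 + j * 2)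
go-4k+3 f j rewrite mod4-r3 j = cong (λ i → 6 + j * 4 + 2 * go f i) (2*[k+j]+1≡1+k*2+j*2 1 j)

data RecursionCase : ℕ → Set where
  init0 : RecursionCase 0
  init1 : RecursionCase 1
  init2 : RecursionCase 2
  init3 : RecursionCase 3
  init4 : RecursionCase 4
  init5 : RecursionCase 5
  at4k  : ∀ j → RecursionCase (8 + j * 4)
  at4k+1  : ∀ j → RecursionCase (9 + j * 4)
  at4k+2  : ∀ j → RecursionCase (6 + j * 4)
  at4k+3  : ∀ j → RecursionCase (7 + j * 4)

recursionCase : ∀ n → RecursionCase n
recursionCase 0 = init0
recursionCase 1 = init1
recursionCase 2 = init2
recursionCase 3 = init3
recursionCase (suc (suc (suc (suc n)))) with recursionCase n
... | init0  = init4
... | init1  = init5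
... | init2  = at4k+2 0
... | init3  = at4k+3 0
... | init4  = at4k 0
... | init5  = at4k+1 0
... | at4k j = at4k (suc j)
... | at4k+1 j = at4k+1 (suc j)
... | at4k+2 j = at4k+2 (suc j)
... | at4k+3 j = at4k+3 (suc j)

halving-≤ : ∀ a b j {f} → a ≤ b → suc (b + j * 4) ≤ suc f → a + j * 2 ≤ f
halving-≤ a b j a≤b bound = ≤-trans (+-mono-≤ a≤b (*-monoʳ-≤ j ≤-by-computation)) (≤-pred bound)

go-fuel-irrelevant : ∀ f g n → n ≤ f → n ≤ g → go f n ≡ go g n
go-fuel-irrelevant zero    zero    0 _ _ = refl
go-fuel-irrelevant zero    (suc g) 0 _ _ = refl
go-fuel-irrelevant (suc f) zero    0 _ _ = refl
go-fuel-irrelevant (suc f) (suc g) n = byCase (recursionCase n)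
  where
  recurse : ∀ a b j {_ : T (a ≤ᵇ b)} → suc (b + j * 4) ≤ suc f → suc (b + j * 4) ≤ suc g →
            go f (a + j * 2) ≡ go g (a + j * 2)
  recurse a b j {a≤ᵇb} p q =
    go-fuel-irrelevant f g _ (halving-≤ a b j (≤ᵇ⇒≤ a b a≤ᵇb) p) (halving-≤ a b j (≤ᵇ⇒≤ a b a≤ᵇb) q)

  byCase : ∀ {n} → RecursionCase n → n ≤ suc f → n ≤ suc g → go (suc f) n ≡ go (suc g) n
  byCase init0 _ _ = refl
  byCase init1 _ _ = refl
  byCase init2 _ _ = refl
  byCase init3 _ _ = refl
  byCase init4 _ _ = refl
  byCase init5 _ _ = refl
  byCase (at4k j) p q = trans (go-4k f j) (trans
    (cong (7 + j * 4 +_) (cong₂ _+_ (recurse 4 7 j p q) (recurse 3 7 j p q)))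
    (sym (go-4k g j)))
  byCase (at4k+1 j) p q = trans (go-4k+1 f j) (trans
    (cong (8 + j * 4 +_) (cong₂ _+_ (recurse 5 8 j p q) (recurse 3 8 j p q)))
    (sym (go-4k+1 g j)))
  byCase (at4k+2 j) p q = trans (go-4k+2 f j) (trans
    (cong (5 + j * 4 +_) (cong₂ _+_ (recurse 3 5 j p q) (recurse 2 5 j p q)))
    (sym (go-4k+2 g j)))
  byCase (at4k+3 j) p q = trans (go-4k+3 f j) (trans
    (cong (λ t → 6 + j * 4 + 2 * t) (recurse 3 6 j p q))
    (sym (go-4k+3 g j)))

go-halving≡x : ∀ a b j → a ≤ b → go (b + j * 4) (a + j * 2) ≡ x (a + j * 2)
go-halving≡x a b j a≤b = go-fuel-irrelevant _ _ _ (halving-≤ a b j a≤b ≤-refl) ≤-refl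

x-4k : ∀ j → x (8 + j * 4) ≡ 7 + j * 4 + (x (4 + j * 2) + x (3 + j * 2))
x-4k j = trans (go-4k _ j) (cong (7 + j * 4 +_) (cong₂ _+_
  (go-halving≡x 4 7 j ≤-by-computation) (go-halving≡x 3 7 j ≤-by-computation)))

x-4k+1 : ∀ j → x (9 + j * 4) ≡ 8 + j * 4 + (x (5 + j * 2) + x (3 + j * 2))
x-4k+1 j = trans (go-4k+1 _ j) (cong (8 + j * 4 +_) (cong₂ _+_
  (go-halving≡x 5 8 j ≤-by-computation) (go-halving≡x 3 8 j ≤-by-computation)))

x-4k+2 : ∀ j → x (6 + j * 4) ≡ 5 + j * 4 + (x (3 + j * 2) + x (2 + j * 2))
x-4k+2 j = trans (go-4k+2 _ j) (cong (5 + j * 4 +_) (cong₂ _+_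
  (go-halving≡x 3 5 j ≤-by-computation) (go-halving≡x 2 5 j ≤-by-computation)))

x-4k+3 : ∀ j → x (7 + j * 4) ≡ 6 + j * 4 + 2 * x (3 + j * 2)
x-4k+3 j = trans (go-4k+3 _ j) (cong (λ t → 6 + j * 4 + 2 * t) (go-halving≡x 3 6 j ≤-by-computation))

cross-≤-trans : ∀ {a₀ a₁ b₀ b₁ c₀ c₁} →
                a₁ + b₀ ≤ b₁ + a₀ → b₁ + c₀ ≤ c₁ + b₀ → a₁ + c₀ ≤ c₁ + a₀
cross-≤-trans {a₀} {a₁} {b₀} {b₁} {c₀} {c₁} ab bc = +-cancelʳ-≤ (b₀ + b₁) _ _ (begin
  a₁ + c₀ + (b₀ + b₁)    ≡⟨ solve (a₁ ∷ b₀ ∷ b₁ ∷ c₀ ∷ []) ⟩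
  (a₁ + b₀) + (b₁ + c₀)  ≤⟨ +-mono-≤ ab bc ⟩
  (b₁ + a₀) + (c₁ + b₀)  ≡⟨ solve (a₀ ∷ b₀ ∷ b₁ ∷ c₁ ∷ []) ⟩
  c₁ + a₀ + (b₀ + b₁)    ∎)
  where open ≤-Reasoning

cross-≤-suc : ∀ {a₀ a₁ b₀ b₁ A₀ A₁ B₀ B₁} → a₁ + b₀ ≤ b₁ + a₀ →
              A₁ + a₀ ≡ suc (A₀ + a₁) → B₁ + b₀ ≡ suc (B₀ + b₁) → A₁ + B₀ ≤ B₁ + A₀
cross-≤-suc {a₀} {a₁} {b₀} {b₁} {A₀} {A₁} {B₀} {B₁} ab stepA stepB =
  +-cancelʳ-≤ (a₀ + b₀) _ _ (begin
    A₁ + B₀ + (a₀ + b₀)            ≡⟨ solve (A₁ ∷ B₀ ∷ a₀ ∷ b₀ ∷ []) ⟩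
    (A₁ + a₀) + (B₀ + b₀)          ≡⟨ cong (_+ (B₀ + b₀)) stepA ⟩
    suc (A₀ + a₁) + (B₀ + b₀)      ≡⟨ solve (A₀ ∷ a₁ ∷ B₀ ∷ b₀ ∷ []) ⟩
    suc (A₀ + B₀) + (a₁ + b₀)      ≤⟨ +-monoʳ-≤ (suc (A₀ + B₀)) ab ⟩
    suc (A₀ + B₀) + (b₁ + a₀)      ≡⟨ solve (A₀ ∷ B₀ ∷ b₁ ∷ a₀ ∷ []) ⟩
    suc (B₀ + b₁) + (A₀ + a₀)      ≡⟨ cong (_+ (A₀ + a₀)) stepB ⟨
    (B₁ + b₀) + (A₀ + a₀)          ≡⟨ solve (B₁ ∷ b₀ ∷ A₀ ∷ a₀ ∷ []) ⟩
    B₁ + A₀ + (a₀ + b₀)            ∎)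
  where open ≤-Reasoning

-- Δf a ≤ Δf b for Δf n = f (suc n) − f n, with the subtractions moved across.
ΔLe : (ℕ → ℕ) → ℕ → ℕ → Set
ΔLe f a b = f (suc a) + f b ≤ f (suc b) + f a

-- Δf A = 1 + Δf a, in the same subtraction-free form.
ΔStep : (ℕ → ℕ) → ℕ → ℕ → Set
ΔStep f A a = f (suc A) + f a ≡ suc (f A + f (suc a))

ΔLe-trans : ∀ f {a b c} → ΔLe f a b → ΔLe f b c → ΔLe f a c
ΔLe-trans f {a} {b} {c} = cross-≤-trans {f a} {f (suc a)} {f b} {f (suc b)} {f c} {f (suc c)}

ΔLe-step : ∀ f {a b A B} → ΔLe f a b → ΔStep f A a → ΔStep f B b → ΔLe f A B
ΔLe-step f {a} {b} {A} {B} =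
  cross-≤-suc {f a} {f (suc a)} {f b} {f (suc b)} {f A} {f (suc A)} {f B} {f (suc B)}

Δx-4k : ∀ j → ΔStep x (8 + j * 4) (4 + j * 2)
Δx-4k j = begin
  x (9 + j * 4) + x (4 + j * 2)
    ≡⟨ cong (_+ x (4 + j * 2)) (x-4k+1 j) ⟩
  8 + j * 4 + (x (5 + j * 2) + x (3 + j * 2)) + x (4 + j * 2)
    ≡⟨ rearrange (j * 4) (x (5 + j * 2)) (x (3 + j * 2)) (x (4 + j * 2)) ⟩
  suc (7 + j * 4 + (x (4 + j * 2) + x (3 + j * 2)) + x (5 + j * 2))
    ≡⟨ cong (λ t → suc (t + x (5 + j * 2))) (x-4k j) ⟨
  suc (x (8 + j * 4) + x (5 + j * 2)) ∎
  where
  open ≡-Reasoning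
  rearrange : ∀ J u v w → 8 + J + (u + v) + w ≡ suc (7 + J + (w + v) + u)
  rearrange = solve-∀

Δx-4k+1 : ∀ j → ΔStep x (9 + j * 4) (3 + j * 2)
Δx-4k+1 j = begin
  x (10 + j * 4) + x (3 + j * 2)
    ≡⟨ cong (_+ x (3 + j * 2)) (x-4k+2 (suc j)) ⟩
  9 + j * 4 + (x (5 + j * 2) + x (4 + j * 2)) + x (3 + j * 2)
    ≡⟨ rearrange (j * 4) (x (5 + j * 2)) (x (4 + j * 2)) (x (3 + j * 2)) ⟩
  suc (8 + j * 4 + (x (5 + j * 2) + x (3 + j * 2)) + x (4 + j * 2))
    ≡⟨ cong (λ t → suc (t + x (4 + j * 2))) (x-4k+1 j) ⟨
  suc (x (9 + j * 4) + x (4 + j * 2)) ∎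
  where
  open ≡-Reasoning
  rearrange : ∀ J u v w → 9 + J + (u + v) + w ≡ suc (8 + J + (u + w) + v)
  rearrange = solve-∀

Δx-4k+2 : ∀ j → ΔStep x (6 + j * 4) (2 + j * 2)
Δx-4k+2 j = begin
  x (7 + j * 4) + x (2 + j * 2)
    ≡⟨ cong (_+ x (2 + j * 2)) (x-4k+3 j) ⟩
  6 + j * 4 + 2 * x (3 + j * 2) + x (2 + j * 2)
    ≡⟨ rearrange (j * 4) (x (3 + j * 2)) (x (2 + j * 2)) ⟩
  suc (5 + j * 4 + (x (3 + j * 2) + x (2 + j * 2)) + x (3 + j * 2))
    ≡⟨ cong (λ t → suc (t + x (3 + j * 2))) (x-4k+2 j) ⟨
  suc (x (6 + j * 4) + x (3 + j * 2)) ∎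
  where
  open ≡-Reasoning
  rearrange : ∀ J u v → 6 + J + 2 * u + v ≡ suc (5 + J + (u + v) + u)
  rearrange = solve-∀

Δx-4k+3 : ∀ j → ΔStep x (7 + j * 4) (3 + j * 2)
Δx-4k+3 j = begin
  x (8 + j * 4) + x (3 + j * 2)
    ≡⟨ cong (_+ x (3 + j * 2)) (x-4k j) ⟩
  7 + j * 4 + (x (4 + j * 2) + x (3 + j * 2)) + x (3 + j * 2)
    ≡⟨ rearrange (j * 4) (x (4 + j * 2)) (x (3 + j * 2)) ⟩
  suc (6 + j * 4 + 2 * x (3 + j * 2) + x (4 + j * 2))
    ≡⟨ cong (λ t → suc (t + x (4 + j * 2))) (x-4k+3 j) ⟨
  suc (x (7 + j * 4) + x (4 + j * 2)) ∎
  where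
  open ≡-Reasoning
  rearrange : ∀ J u v → 7 + J + (u + v) + v ≡ suc (6 + J + 2 * v + u)
  rearrange = solve-∀

ΔLe⇒concave : ∀ f a → ΔLe f (suc a) a → f a + f (suc (suc a)) ≤ 2 * f (suc a)
ΔLe⇒concave f a =
  subst₂ _≤_ (+-comm (f (suc (suc a))) (f a)) (cong (f (suc a) +_) (sym (+-identityʳ (f (suc a)))))

ΔLe⇒convex : ∀ f a → ΔLe f a (suc a) → 2 * f (suc a) ≤ f a + f (suc (suc a))
ΔLe⇒convex f a =
  subst₂ _≤_ (cong (f (suc a) +_) (sym (+-identityʳ (f (suc a))))) (+-comm (f (suc (suc a))) (f a))

data HalvingCase : ℕ → Set where
  small0 : HalvingCase 0
  small1 : HalvingCase 1
  small2 : HalvingCase 2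
  odd    : ∀ i → HalvingCase (3 + i * 2)
  even   : ∀ i → HalvingCase (4 + i * 2)

halvingCase : ∀ m → HalvingCase m
halvingCase 0 = small0
halvingCase 1 = small1
halvingCase (suc (suc m)) with halvingCase m
... | small0 = small2
... | small1 = odd 0
... | small2 = even 0
... | odd i  = odd (suc i)
... | even i = even (suc i)

1+i<3+i*2 : ∀ i → 1 + i < 3 + i * 2
1+i<3+i*2 i = s≤s (s≤s (m≤n⇒m≤1+n (m≤m*n i 2)))

1+i<4+i*2 : ∀ i → 1 + i < 4 + i * 2
1+i<4+i*2 i = m≤n⇒m≤1+n (1+i<3+i*2 i)

Δx-2m+2≤Δx-2m+1 : ∀ m → ΔLe x (2 + m * 2) (1 + m * 2)
Δx-2m+2≤Δx-2m+1 m = byHalving (halvingCase m) (<-wellFounded m)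
  where
  byHalving : ∀ {m} → HalvingCase m → Acc _<_ m → ΔLe x (2 + m * 2) (1 + m * 2)
  byHalving small0 _ = ≤-by-computation
  byHalving small1 _ = ≤-by-computation
  byHalving small2 _ = ≤-by-computation
  byHalving (odd i) (acc rec) = subst (λ t → ΔLe x (8 + t) (7 + t)) (sym (*-assoc i 2 2))
    (ΔLe-step x {4 + i * 2} {3 + i * 2} {8 + i * 4} {7 + i * 4}
      (byHalving (halvingCase (1 + i)) (rec (1+i<3+i*2 i))) (Δx-4k i) (Δx-4k+3 i))
  byHalving (even i) (acc rec) = subst (λ t → ΔLe x (10 + t) (9 + t)) (sym (*-assoc i 2 2))
    (ΔLe-step x {4 + i * 2} {3 + i * 2} {10 + i * 4} {9 + i * 4}
      (byHalving (halvingCase (1 + i)) (rec (1+i<4+i*2 i)))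
      (Δx-4k+2 (suc i)) (Δx-4k+1 i))

Δx-2m+1≤Δx-2m+3 : ∀ m → ΔLe x (1 + m * 2) (3 + m * 2)
Δx-2m+1≤Δx-2m+3 m = byHalving (halvingCase m) (<-wellFounded m)
  where
  byHalving : ∀ {m} → HalvingCase m → Acc _<_ m → ΔLe x (1 + m * 2) (3 + m * 2)
  byHalving small0 _ = ≤-by-computation
  byHalving small1 _ = ≤-by-computation
  byHalving small2 _ = ≤-by-computation
  byHalving (odd i) _ = subst (λ t → ΔLe x (7 + t) (9 + t)) (sym (*-assoc i 2 2))
    (ΔLe-step x {3 + i * 2} {3 + i * 2} {7 + i * 4} {9 + i * 4} ≤-refl (Δx-4k+3 i) (Δx-4k+1 i))
  byHalving (even i) (acc rec) = subst (λ t → ΔLe x (9 + t) (11 + t)) (sym (*-assoc i 2 2))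
    (ΔLe-step x {3 + i * 2} {5 + i * 2} {9 + i * 4} {11 + i * 4}
      (byHalving (halvingCase (1 + i)) (rec (1+i<4+i*2 i)))
      (Δx-4k+1 i) (Δx-4k+3 (suc i)))

concave-at-even : ∀ m → 2 * x (2 + m * 2) ≥ x (1 + m * 2) + x (2 + m * 2 + 1)
concave-at-even m = subst (λ t → x (1 + m * 2) + x t ≤ 2 * x (2 + m * 2)) (+-comm 1 (2 + m * 2))
  (ΔLe⇒concave x (1 + m * 2) (Δx-2m+2≤Δx-2m+1 m))

convex-at-odd : ∀ m → 2 * x (3 + m * 2) ≤ x (2 + m * 2) + x (3 + m * 2 + 1)
convex-at-odd m = subst (λ t → 2 * x (3 + m * 2) ≤ x (2 + m * 2) + x t) (+-comm 1 (3 + m * 2))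
  (ΔLe⇒convex x (2 + m * 2)
    (ΔLe-trans x {2 + m * 2} {1 + m * 2} {3 + m * 2} (Δx-2m+2≤Δx-2m+1 m) (Δx-2m+1≤Δx-2m+3 m)))

lemma8 : (n : ℕ) → n ≥ 2 →
           ((n % 2 ≡ 0 → 2 * x n ≥ x (n ∸ 1) + x (n + 1)) ×
            (n % 2 ≡ 1 → 2 * x n ≤ x (n ∸ 1) + x (n + 1)))
lemma8 n n≥2 with halvingCase n
lemma8 _ ()        | small0
lemma8 _ (s≤s ())  | small1
lemma8 _ _         | small2 = (λ _ → concave-at-even 0) , λ ()
lemma8 _ _         | odd i  =
  (λ n%2≡0 → contradiction (trans (sym ([m+kn]%n≡m%n 3 i 2)) n%2≡0) 1+n≢0) , λ _ → convex-at-odd i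
lemma8 _ _         | even i =
  (λ _ → concave-at-even (suc i)) , λ n%2≡1 → contradiction (trans (sym ([m+kn]%n≡m%n 4 i 2)) n%2≡1) 0≢1+n
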